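{- Let $G$ be a free partially commutative group with generators $g_1,\dots,g_k$. For any word $w=a_1\cdots a_t$ in the symbols $g_i^{\pm1}$, one has $w=1$ in $G$ if and only if there exists a perfect matching $M$ on $\{1,\dots,t\}$ such that (i) if $\{i,j\}\in M$ then $a_j=a_i^{ -1}$; and (ii) if two pairs $\{i,j\},\{i',j'\}\in M$ cross then $a_i$ and $a_{i'}$ are independent.
   Context: $G$ is generated by $g_1,\dots,g_k$ with relations $g_ig_j=g_jg_i$ for $\{i,j\}$ in a given set $E$ of unordered pairs with $i\ne j$. Symbols are $g_i,g_i^{ -1}$, with $(g_i^{ -1})^{ -1}=g_i$. Symbols $a\in\{g_i,g_i^{ -1}\}$ and $b\in\{g_j,g_j^{ -1}\}$ are independent if $\{i,j\}\in E$. A perfect matching on $\{1,\dots,t\}$ is a partition into pairs; pairs $\{i,j\}$ and $\{i',j'\}$ with $i<j$, $i'<j'$ cross if $i<i'<j<j'$ or $i'<i<j'<j$. -}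

module Defs where

open import Data.Nat using (ℕ)
open import Data.Fin using (Fin; _<_)
open import Data.Bool using (Bool; true; false; not)
open import Data.Product using (_×_; _,_; proj₁)
open import Data.Sum using (_⊎_)
open import Data.List using (List; []; _∷_; _++_; length; lookup)
open import Relation.Binary.PropositionalEquality using (_≡_)
open import Relation.Nullary using (¬_)

-- A symbol g_i^{±1}: (i , true) is g_i, (i , false) is g_i⁻¹.
Symbol : ℕ → Set
Symbol k = Fin k × Bool

gen : ∀ {k} → Fin k → Symbol k
gen i = (i , true)

inv : ∀ {k} → Symbol k → Symbol k
inv (i , b) = (i , not b)

Word : ℕ → Set
Word k = List (Symbol k)

-- The commutation set E of unordered pairs is given as a relation
-- E i j on indices; {i,j} ∈ E means E i j ⊎ E j i.
InE : ∀ {k} → (Fin k → Fin k → Set) → Fin k → Fin k → Set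
InE E i j = E i j ⊎ E j i

Independent : ∀ {k} → (Fin k → Fin k → Set) → Symbol k → Symbol k → Set
Independent E a b = InE E (proj₁ a) (proj₁ b)

data _⊢_≈_ {k} (E : Fin k → Fin k → Set) : Word k → Word k → Set where
  cancel : ∀ u v a → E ⊢ (u ++ a ∷ inv a ∷ v) ≈ (u ++ v)
  comm   : ∀ u v i j → InE E i j →
           E ⊢ (u ++ gen i ∷ gen j ∷ v) ≈ (u ++ gen j ∷ gen i ∷ v)
  ≈-refl  : ∀ {u} → E ⊢ u ≈ u
  ≈-sym   : ∀ {u v} → E ⊢ u ≈ v → E ⊢ v ≈ u
  ≈-trans : ∀ {u v w} → E ⊢ u ≈ v → E ⊢ v ≈ w → E ⊢ u ≈ w

IsTrivial : ∀ {k} → (Fin k → Fin k → Set) → Word k → Set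
IsTrivial E w = E ⊢ w ≈ []

-- A perfect matching on a finite set of positions Fin t, encoded as a
-- fixed-point-free involution (i ↦ its partner).
record PerfectMatching (t : ℕ) : Set where
  field
    partner    : Fin t → Fin t
    involutive : ∀ i → partner (partner i) ≡ i
    noFixed    : ∀ i → ¬ (partner i ≡ i)
open PerfectMatching public

GoodMatching : ∀ {k} → (Fin k → Fin k → Set) → (w : Word k) →
               PerfectMatching (length w) → Set
GoodMatching E w M =
  (∀ i → lookup w (partner M i) ≡ inv (lookup w i)) ×
  (∀ i i' → i < i' → i' < partner M i → partner M i < partner M i' →
     Independent E (lookup w i) (lookup w i'))

-- We work with `Pairing`s: good matchings with positions in ℕ and with the crossing condition
-- stated through the symmetric boolean test `crosses` (exactly one end of one chord lies between
-- the ends of the other), which is unaffected by reversing or exchanging chords.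
--  * Order combinatorics on ℕ: the algebra of `crosses`, and the renumberings `skip` (opening
--    a gap of two positions) and `swapAt` (exchanging two neighbours).
--  * Trivial ⇒ matching: pairings transfer along both directions of every defining relation
--    (`Delete`, `Insert`, `Swap`), and the empty word has the empty pairing.
--  * Matching ⇒ trivial: the first position closing a chord closes an innermost chord, all of
--    whose inner letters are independent of its first letter; commuting that letter to its
--    partner and cancelling shortens the word (`cancel-chord`), and we induct on length.
--  * Pairings on ℕ and good matchings on Fin (length w) correspond (`FromOrdered` restores the
--    orientation-free crossing condition); the theorem follows.
module Submission where

open import Defs
open import Data.Nat using (ℕ; zero; suc; _+_; _∸_; _≤_; _<_; _<ᵇ_; z≤n; s≤s; s≤s⁻¹)
open import Data.Nat.Properties
  using (_≟_; _<?_; suc-injective; ≤-refl; ≤-trans; <-trans; ≤-<-trans; <⇒≤; <-irrefl;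
         ≮⇒≥; ≤∧≢⇒<; ≤-reflexive; m≤m+n; +-suc; +-identityʳ; m+[n∸m]≡n; n≤1+n; n<1+n;
         <⇒≱; <ᵇ⇒<; <⇒<ᵇ)
open import Data.Bool using (Bool; true; false; not; _xor_)
open import Data.Bool.Properties
  using (not-involutive; ¬-not; T-≡; xor-comm; xor-same; xor-annihilates-not; xor-∧-commutativeRing)
open import Data.Product using (Σ; _×_; _,_; proj₁; proj₂)
open import Data.Sum using (_⊎_; inj₁; inj₂; [_,_]′)
open import Data.Empty using (⊥; ⊥-elim)
open import Data.Fin using (Fin; zero; suc; toℕ; fromℕ<)
open import Data.Fin.Properties using (toℕ-injective; toℕ<n; toℕ-fromℕ<; fromℕ<-toℕ)
open import Data.List using ([]; _∷_; _++_; length; lookup)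
open import Data.List.Properties using (++-assoc; length-++)
open import Relation.Binary.PropositionalEquality
open import Relation.Nullary using (¬_; Dec; yes; no)
open import Function.Bundles using (_⇔_; mk⇔; Equivalence)
open import Algebra.Bundles using (CommutativeRing)
open CommutativeRing xor-∧-commutativeRing using (+-commutativeSemigroup)
open import Algebra.Properties.CommutativeSemigroup +-commutativeSemigroup using (interchange)

open ≡-Reasoning

xor-through : ∀ a x b → a xor b ≡ (a xor x) xor (x xor b)
xor-through false false b = refl
xor-through false true  b = sym (not-involutive b)
xor-through true  false b = refl
xor-through true  true  b = refl

false≢true : false ≢ true
false≢true ()

xor-true : ∀ a b → a xor b ≡ true → a ≡ true ⊎ b ≡ true
xor-true true  b _ = inj₁ refl
xor-true false b h = inj₂ h

<ᵇ-sound : ∀ x y → (x <ᵇ y) ≡ true → x < y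
<ᵇ-sound x y e = <ᵇ⇒< x y (Equivalence.from T-≡ e)

<ᵇ-true : ∀ {x y} → x < y → (x <ᵇ y) ≡ true
<ᵇ-true x<y = Equivalence.to T-≡ (<⇒<ᵇ x<y)

<ᵇ-false : ∀ {x y} → y ≤ x → (x <ᵇ y) ≡ false
<ᵇ-false {x} {y} y≤x = ¬-not (λ e → <⇒≱ (<ᵇ-sound x y e) y≤x)

<ᵇ-flip : ∀ {x y} → x ≢ y → (x <ᵇ y) ≡ not (y <ᵇ x)
<ᵇ-flip {zero}  {zero}  x≢y = ⊥-elim (x≢y refl)
<ᵇ-flip {zero}  {suc y} _   = refl
<ᵇ-flip {suc x} {zero}  _   = refl
<ᵇ-flip {suc x} {suc y} x≢y = <ᵇ-flip (λ e → x≢y (cong suc e))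

<ᵇ-nextʳ : ∀ {x m} → x ≢ m → (x <ᵇ m) ≡ (x <ᵇ suc m)
<ᵇ-nextʳ {zero}  {zero}  x≢m = ⊥-elim (x≢m refl)
<ᵇ-nextʳ {zero}  {suc m} _   = refl
<ᵇ-nextʳ {suc x} {zero}  _   = refl
<ᵇ-nextʳ {suc x} {suc m} x≢m = <ᵇ-nextʳ (λ e → x≢m (cong suc e))

<ᵇ-nextˡ : ∀ {m y} → y ≢ suc m → (m <ᵇ y) ≡ (suc m <ᵇ y)
<ᵇ-nextˡ {m}     {zero}        _   = refl
<ᵇ-nextˡ {zero}  {suc zero}    y≢1 = ⊥-elim (y≢1 refl)
<ᵇ-nextˡ {zero}  {suc (suc y)} _   = refl
<ᵇ-nextˡ {suc m} {suc y}       y≢m = <ᵇ-nextˡ (λ e → y≢m (cong suc e))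

-- `between a b c`: the point c lies strictly between a and b (for c ∉ {a, b}).
between : ℕ → ℕ → ℕ → Bool
between a b c = (c <ᵇ a) xor (c <ᵇ b)

-- The chords {a, b} and {c, d} cross iff exactly one of c, d lies between a and b.
-- Working with this symmetric boolean test spares us all case distinctions on orientation.
crosses : ℕ → ℕ → ℕ → ℕ → Bool
crosses a b c d = between a b c xor between a b d

crosses-flipˡ : ∀ a b c d → crosses a b c d ≡ crosses b a c d
crosses-flipˡ a b c d = cong₂ _xor_ (xor-comm (c <ᵇ a) (c <ᵇ b)) (xor-comm (d <ᵇ a) (d <ᵇ b))

crosses-flipʳ : ∀ a b c d → crosses a b c d ≡ crosses a b d c
crosses-flipʳ a b c d = xor-comm (between a b c) (between a b d)

crosses-sym : ∀ {a b c d} → a ≢ c → a ≢ d → b ≢ c → b ≢ d → crosses c d a b ≡ crosses a b c d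
crosses-sym {a} {b} {c} {d} a≢c a≢d b≢c b≢d = begin
  ((a <ᵇ c) xor (a <ᵇ d)) xor ((b <ᵇ c) xor (b <ᵇ d))
    ≡⟨ interchange (a <ᵇ c) (a <ᵇ d) (b <ᵇ c) (b <ᵇ d) ⟩
  ((a <ᵇ c) xor (b <ᵇ c)) xor ((a <ᵇ d) xor (b <ᵇ d))
    ≡⟨ cong₂ _xor_ (cong₂ _xor_ (<ᵇ-flip a≢c) (<ᵇ-flip b≢c))
                   (cong₂ _xor_ (<ᵇ-flip a≢d) (<ᵇ-flip b≢d)) ⟩
  (not (c <ᵇ a) xor not (c <ᵇ b)) xor (not (d <ᵇ a) xor not (d <ᵇ b))
    ≡⟨ cong₂ _xor_ (xor-annihilates-not (c <ᵇ a) (c <ᵇ b)) (xor-annihilates-not (d <ᵇ a) (d <ᵇ b)) ⟩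
  crosses a b c d ∎

crosses-rename : ∀ (f : ℕ → ℕ) a b c d →
  (f c <ᵇ f a) ≡ (c <ᵇ a) → (f c <ᵇ f b) ≡ (c <ᵇ b) →
  (f d <ᵇ f a) ≡ (d <ᵇ a) → (f d <ᵇ f b) ≡ (d <ᵇ b) →
  crosses (f a) (f b) (f c) (f d) ≡ crosses a b c d
crosses-rename f a b c d e₁ e₂ e₃ e₄ = cong₂ _xor_ (cong₂ _xor_ e₁ e₂) (cong₂ _xor_ e₃ e₄)

-- If q and q' look alike from c and d, a chord {c, d} crossing {a, b} crosses {a, q} or {q', b}:
-- this is how crossings behave when two chords are merged into one.
crosses-split : ∀ a b c d q q' → (c <ᵇ q) ≡ (c <ᵇ q') → (d <ᵇ q) ≡ (d <ᵇ q') →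
  crosses a b c d ≡ crosses a q c d xor crosses q' b c d
crosses-split a b c d q q' eᶜ eᵈ = begin
  between a b c xor between a b d
    ≡⟨ cong₂ _xor_ (split c eᶜ) (split d eᵈ) ⟩
  (between a q c xor between q' b c) xor (between a q d xor between q' b d)
    ≡⟨ interchange (between a q c) (between q' b c) (between a q d) (between q' b d) ⟩
  crosses a q c d xor crosses q' b c d ∎
  where
  split : ∀ x → (x <ᵇ q) ≡ (x <ᵇ q') → between a b x ≡ between a q x xor between q' b x
  split x e = trans (xor-through (x <ᵇ a) (x <ᵇ q) (x <ᵇ b))
                    (cong (λ z → between a q x xor (z xor (x <ᵇ b))) e)

crosses-adjacentˡ : ∀ q q' c d → (c <ᵇ q) ≡ (c <ᵇ q') → (d <ᵇ q) ≡ (d <ᵇ q') →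
  crosses q q' c d ≡ false
crosses-adjacentˡ q q' c d eᶜ eᵈ =
  cong₂ _xor_ (trans (cong (_xor (c <ᵇ q')) eᶜ) (xor-same (c <ᵇ q')))
              (trans (cong (_xor (d <ᵇ q')) eᵈ) (xor-same (d <ᵇ q')))

crosses-adjacentʳ : ∀ q q' c d → (q <ᵇ c) ≡ (q' <ᵇ c) → (q <ᵇ d) ≡ (q' <ᵇ d) →
  crosses c d q q' ≡ false
crosses-adjacentʳ q q' c d eᶜ eᵈ =
  trans (cong (_xor between c d q') (cong₂ _xor_ eᶜ eᵈ)) (xor-same (between c d q'))

interleaved⇒crosses : ∀ {a a' b b'} → a < b → b < a' → a' < b' → crosses a a' b b' ≡ true
interleaved⇒crosses {a} {a'} {b} {b'} a<b b<a' a'<b'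
  rewrite <ᵇ-false (<⇒≤ a<b) | <ᵇ-true b<a' | <ᵇ-false (<⇒≤ (<-trans a<b (<-trans b<a' a'<b')))
        | <ᵇ-false (<⇒≤ a'<b') = refl

crosses⇒interleaved : ∀ {a a' b b'} → b < b' → a' ≢ b' → a < b → crosses a a' b b' ≡ true →
  b < a' × a' < b'
crosses⇒interleaved {a} {a'} {b} {b'} b<b' a'≢b' a<b hX
  rewrite <ᵇ-false (<⇒≤ a<b) | <ᵇ-false (<⇒≤ (<-trans a<b b<b'))
  with b <ᵇ a' in e₁ | b' <ᵇ a' in e₂
... | true  | false = <ᵇ-sound b a' e₁ ,
                      ≤∧≢⇒< (≮⇒≥ (λ h → false≢true (trans (sym e₂) (<ᵇ-true h)))) a'≢b'
... | false | true  = ⊥-elim (<-irrefl refl (<-trans (<ᵇ-sound b' a' e₂)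
                        (≤-<-trans (≮⇒≥ (λ h → false≢true (trans (sym e₁) (<ᵇ-true h)))) b<b')))
... | true  | true  = ⊥-elim (false≢true hX)
... | false | false = ⊥-elim (false≢true hX)

-- Positions of u ++ a ∷ b ∷ v, with m = length u: `OnPair m x` means x is one of the
-- two distinguished positions m, m+1, and `Away m x` that it is neither.
OnPair : ℕ → ℕ → Set
OnPair m x = x ≡ m ⊎ x ≡ suc m

Away : ℕ → ℕ → Set
Away m x = x ≢ m × x ≢ suc m

beyond-away : ∀ {m x} → suc m < x → Away m x
beyond-away 1+m<x = (λ e → <-irrefl (sym e) (<-trans (n<1+n _) 1+m<x)) , (λ e → <-irrefl (sym e) 1+m<x)

away? : ∀ m x → Away m x ⊎ OnPair m x
away? m x with x ≟ m | x ≟ suc m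
... | yes x≡m | _          = inj₂ (inj₁ x≡m)
... | no _    | yes x≡1+m  = inj₂ (inj₂ x≡1+m)
... | no x≢m  | no x≢1+m   = inj₁ (x≢m , x≢1+m)

onPair-<ᵇ : ∀ {m x x'} → OnPair m x → OnPair m x' → ∀ {y} → Away m y → (y <ᵇ x) ≡ (y <ᵇ x')
onPair-<ᵇ (inj₁ refl) (inj₁ refl) _       = refl
onPair-<ᵇ (inj₂ refl) (inj₂ refl) _       = refl
onPair-<ᵇ (inj₁ refl) (inj₂ refl) (y≢m , _) = <ᵇ-nextʳ y≢m
onPair-<ᵇ (inj₂ refl) (inj₁ refl) (y≢m , _) = sym (<ᵇ-nextʳ y≢m)

onPair->ᵇ : ∀ {m x x'} → OnPair m x → OnPair m x' → ∀ {y} → Away m y → (x <ᵇ y) ≡ (x' <ᵇ y)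
onPair->ᵇ (inj₁ refl) (inj₁ refl) _       = refl
onPair->ᵇ (inj₂ refl) (inj₂ refl) _       = refl
onPair->ᵇ (inj₁ refl) (inj₂ refl) (_ , y≢1+m) = <ᵇ-nextˡ y≢1+m
onPair->ᵇ (inj₂ refl) (inj₁ refl) (_ , y≢1+m) = sym (<ᵇ-nextˡ y≢1+m)

onPair-crosses-nothing : ∀ {m x x' y y'} → OnPair m x → OnPair m x' → Away m y → Away m y' →
  crosses x x' y y' ≡ false × crosses y y' x x' ≡ false
onPair-crosses-nothing {x = x} {x'} {y} {y'} px px' ay ay' =
  crosses-adjacentˡ x x' y y' (onPair-<ᵇ px px' ay) (onPair-<ᵇ px px' ay') ,
  crosses-adjacentʳ x x' y y' (onPair->ᵇ px px' ay) (onPair->ᵇ px px' ay')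

-- `skip m n` is the position of the n-th letter of u ++ v inside u ++ a ∷ b ∷ v,
-- and `unskip m` is its inverse on away positions.
skip : ℕ → ℕ → ℕ
skip zero    n       = suc (suc n)
skip (suc m) zero    = zero
skip (suc m) (suc n) = suc (skip m n)

unskip : ℕ → ℕ → ℕ
unskip zero    (suc (suc x)) = x
unskip zero    _             = zero
unskip (suc m) zero          = zero
unskip (suc m) (suc x)       = suc (unskip m x)

skip-away : ∀ m n → Away m (skip m n)
skip-away zero    n       = (λ ()) , (λ ())
skip-away (suc m) zero    = (λ ()) , (λ ())
skip-away (suc m) (suc n) with skip-away m n
... | s≢m , s≢1+m = (λ e → s≢m (suc-injective e)) , (λ e → s≢1+m (suc-injective e))

unskip-skip : ∀ m n → unskip m (skip m n) ≡ n
unskip-skip zero    n       = refl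
unskip-skip (suc m) zero    = refl
unskip-skip (suc m) (suc n) = cong suc (unskip-skip m n)

skip-unskip : ∀ m x → Away m x → skip m (unskip m x) ≡ x
skip-unskip zero    zero          (x≢0 , _)   = ⊥-elim (x≢0 refl)
skip-unskip zero    (suc zero)    (_ , x≢1)   = ⊥-elim (x≢1 refl)
skip-unskip zero    (suc (suc x)) _           = refl
skip-unskip (suc m) zero          _           = refl
skip-unskip (suc m) (suc x)       (x≢m , x≢1+m) =
  cong suc (skip-unskip m x ((λ e → x≢m (cong suc e)) , (λ e → x≢1+m (cong suc e))))

skip-injective : ∀ m {x y} → skip m x ≡ skip m y → x ≡ y
skip-injective m {x} {y} e = trans (sym (unskip-skip m x)) (trans (cong (unskip m) e) (unskip-skip m y))

skip-<ᵇ : ∀ m x y → (skip m x <ᵇ skip m y) ≡ (x <ᵇ y)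
skip-<ᵇ zero    x       y       = refl
skip-<ᵇ (suc m) zero    zero    = refl
skip-<ᵇ (suc m) zero    (suc y) = refl
skip-<ᵇ (suc m) (suc x) zero    = refl
skip-<ᵇ (suc m) (suc x) (suc y) = skip-<ᵇ m x y

skip-crosses : ∀ m a b c d → crosses (skip m a) (skip m b) (skip m c) (skip m d) ≡ crosses a b c d
skip-crosses m a b c d =
  crosses-rename (skip m) a b c d (skip-<ᵇ m c a) (skip-<ᵇ m c b) (skip-<ᵇ m d a) (skip-<ᵇ m d b)

skip-< : ∀ m {n L} → n < L → skip m n < suc (suc L)
skip-< zero    n<L                 = s≤s (s≤s n<L)
skip-< (suc m) {zero}          _   = s≤s z≤n
skip-< (suc m) {suc n} {suc L} n<L = s≤s (skip-< m (s≤s⁻¹ n<L))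

unskip-< : ∀ m {x L} → m ≤ L → Away m x → x < suc (suc L) → unskip m x < L
unskip-< m {x} {L} m≤L ax x<L = lower m (unskip m x) m≤L (subst (_< suc (suc L)) (sym (skip-unskip m x ax)) x<L)
  where
  lower : ∀ m n {L} → m ≤ L → skip m n < suc (suc L) → n < L
  lower zero    n       _         h = s≤s⁻¹ (s≤s⁻¹ h)
  lower (suc m) zero    {suc L} _ _ = s≤s z≤n
  lower (suc m) (suc n) {suc L} m≤L h = s≤s (lower m n (s≤s⁻¹ m≤L) (s≤s⁻¹ h))

swapAt : ℕ → ℕ → ℕ
swapAt zero    zero          = suc zero
swapAt zero    (suc zero)    = zero
swapAt zero    (suc (suc n)) = suc (suc n)
swapAt (suc m) zero          = zero
swapAt (suc m) (suc n)       = suc (swapAt m n)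

swapAt-involutive : ∀ m n → swapAt m (swapAt m n) ≡ n
swapAt-involutive zero    zero          = refl
swapAt-involutive zero    (suc zero)    = refl
swapAt-involutive zero    (suc (suc n)) = refl
swapAt-involutive (suc m) zero          = refl
swapAt-involutive (suc m) (suc n)       = cong suc (swapAt-involutive m n)

swapAt-injective : ∀ m {x y} → swapAt m x ≡ swapAt m y → x ≡ y
swapAt-injective m {x} {y} e =
  trans (sym (swapAt-involutive m x)) (trans (cong (swapAt m) e) (swapAt-involutive m y))

swapAt-here : ∀ m → swapAt m m ≡ suc m
swapAt-here zero    = refl
swapAt-here (suc m) = cong suc (swapAt-here m)

swapAt-there : ∀ m → swapAt m (suc m) ≡ m
swapAt-there zero    = refl
swapAt-there (suc m) = cong suc (swapAt-there m)

swapAt-away : ∀ m x → Away m x → swapAt m x ≡ x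
swapAt-away zero    zero          (x≢0 , _) = ⊥-elim (x≢0 refl)
swapAt-away zero    (suc zero)    (_ , x≢1) = ⊥-elim (x≢1 refl)
swapAt-away zero    (suc (suc x)) _         = refl
swapAt-away (suc m) zero          _         = refl
swapAt-away (suc m) (suc x)       (x≢m , x≢1+m) =
  cong suc (swapAt-away m x ((λ e → x≢m (cong suc e)) , (λ e → x≢1+m (cong suc e))))

swapAt-< : ∀ m {n L} → n < L → suc m < L → swapAt m n < L
swapAt-< zero    {zero}           _   1<L = 1<L
swapAt-< zero    {suc zero}       n<L _   = ≤-<-trans z≤n n<L
swapAt-< zero    {suc (suc n)}    n<L _   = n<L
swapAt-< (suc m) {zero}           n<L _   = n<L
swapAt-< (suc m) {suc n} {suc L}  n<L m<L = s≤s (swapAt-< m (s≤s⁻¹ n<L) (s≤s⁻¹ m<L))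

swapAt-<ᵇ : ∀ m x y → Away m x ⊎ Away m y → (swapAt m x <ᵇ swapAt m y) ≡ (x <ᵇ y)
swapAt-<ᵇ m x y (inj₁ ax) rewrite swapAt-away m x ax with away? m y
... | inj₁ ay          rewrite swapAt-away m y ay = refl
... | inj₂ py@(inj₁ refl) rewrite swapAt-here m  = onPair-<ᵇ (inj₂ refl) py ax
... | inj₂ py@(inj₂ refl) rewrite swapAt-there m = onPair-<ᵇ (inj₁ refl) py ax
swapAt-<ᵇ m x y (inj₂ ay) rewrite swapAt-away m y ay with away? m x
... | inj₁ ax          rewrite swapAt-away m x ax = refl
... | inj₂ px@(inj₁ refl) rewrite swapAt-here m  = onPair->ᵇ (inj₂ refl) px ay
... | inj₂ px@(inj₂ refl) rewrite swapAt-there m = onPair->ᵇ (inj₁ refl) px ay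

swapAt-crosses : ∀ m a b c d → (Away m a × Away m b) ⊎ (Away m c × Away m d) →
  crosses (swapAt m a) (swapAt m b) (swapAt m c) (swapAt m d) ≡ crosses a b c d
swapAt-crosses m a b c d (inj₁ (aa , ab)) =
  crosses-rename (swapAt m) a b c d (swapAt-<ᵇ m c a (inj₂ aa)) (swapAt-<ᵇ m c b (inj₂ ab))
                 (swapAt-<ᵇ m d a (inj₂ aa)) (swapAt-<ᵇ m d b (inj₂ ab))
swapAt-crosses m a b c d (inj₂ (ac , ad)) =
  crosses-rename (swapAt m) a b c d (swapAt-<ᵇ m c a (inj₁ ac)) (swapAt-<ᵇ m c b (inj₁ ac))
                 (swapAt-<ᵇ m d a (inj₁ ad)) (swapAt-<ᵇ m d b (inj₁ ad))

involution-injective : ∀ (p : ℕ → ℕ) {L} → (∀ {n} → n < L → p (p n) ≡ n) →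
  ∀ {x y} → x < L → y < L → p x ≡ p y → x ≡ y
involution-injective p p-involutive x<L y<L e =
  trans (sym (p-involutive x<L)) (trans (cong p e) (p-involutive y<L))

least-witness : {P : ℕ → Set} → (∀ n → Dec (P n)) → ∀ {n} → P n →
  Σ ℕ λ j → j ≤ n × P j × (∀ x → x < j → ¬ P x)
least-witness {P} P? {n} Pn = search n 0 refl (λ _ ())
  where
  search : ∀ r q → q + r ≡ n → (∀ x → x < q → ¬ P x) →
    Σ ℕ λ j → j ≤ n × P j × (∀ x → x < j → ¬ P x)
  search zero q q+0≡n below =
    q , ≤-reflexive q≡n , subst P (sym q≡n) Pn , below
    where
    q≡n : q ≡ n
    q≡n = trans (sym (+-identityʳ q)) q+0≡n
  search (suc r) q q+r≡n below with P? q
  ... | yes Pq = q , subst (q ≤_) q+r≡n (m≤m+n q (suc r)) , Pq , below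
  ... | no ¬Pq = search r (suc q) (trans (sym (+-suc q r)) q+r≡n) below'
    where
    below' : ∀ x → x < suc q → ¬ P x
    below' x x<1+q with x ≟ q
    ... | yes refl = ¬Pq
    ... | no x≢q   = below x (≤∧≢⇒< (s≤s⁻¹ x<1+q) x≢q)

module _ {k : ℕ} where

  inv-involutive : (a : Symbol k) → inv (inv a) ≡ a
  inv-involutive (i , b) = cong (i ,_) (not-involutive b)

  -- The n-th letter of a word; the default d is returned past the end of the word.
  nth : Symbol k → Word k → ℕ → Symbol k
  nth d []      n       = d
  nth d (x ∷ w) zero    = x
  nth d (x ∷ w) (suc n) = nth d w n

  module _ (d a b : Symbol k) where

    nth-here : ∀ u v → nth d (u ++ a ∷ b ∷ v) (length u) ≡ a
    nth-here []      v = refl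
    nth-here (x ∷ u) v = nth-here u v

    nth-there : ∀ u v → nth d (u ++ a ∷ b ∷ v) (suc (length u)) ≡ b
    nth-there []      v = refl
    nth-there (x ∷ u) v = nth-there u v

    nth-skip : ∀ u v n → nth d (u ++ v) n ≡ nth d (u ++ a ∷ b ∷ v) (skip (length u) n)
    nth-skip []      v n       = refl
    nth-skip (x ∷ u) v zero    = refl
    nth-skip (x ∷ u) v (suc n) = nth-skip u v n

    nth-swapAt : ∀ u v n → nth d (u ++ b ∷ a ∷ v) n ≡ nth d (u ++ a ∷ b ∷ v) (swapAt (length u) n)
    nth-swapAt []      v zero          = refl
    nth-swapAt []      v (suc zero)    = refl
    nth-swapAt []      v (suc (suc n)) = refl
    nth-swapAt (x ∷ u) v zero          = refl
    nth-swapAt (x ∷ u) v (suc n)       = nth-swapAt u v n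

  length-insert : ∀ (a b : Symbol k) u v → length (u ++ a ∷ b ∷ v) ≡ suc (suc (length (u ++ v)))
  length-insert a b []      v = refl
  length-insert a b (x ∷ u) v = cong suc (length-insert a b u v)

  length-swap : ∀ (a b : Symbol k) u v → length (u ++ b ∷ a ∷ v) ≡ length (u ++ a ∷ b ∷ v)
  length-swap a b u v = trans (length-insert b a u v) (sym (length-insert a b u v))

  there-< : ∀ (a b : Symbol k) u v → suc (length u) < length (u ++ a ∷ b ∷ v)
  there-< a b []      v = s≤s (s≤s z≤n)
  there-< a b (x ∷ u) v = s≤s (there-< a b u v)

  here-< : ∀ (a b : Symbol k) u v → length u < length (u ++ a ∷ b ∷ v)
  here-< a b u v = <-trans (n<1+n (length u)) (there-< a b u v)

  cut : ∀ (w : Word k) q → suc q < length w →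
        Σ (Word k) λ u → Σ (Symbol k) λ a → Σ (Symbol k) λ b → Σ (Word k) λ v →
        (w ≡ u ++ a ∷ b ∷ v) × (length u ≡ q)
  cut (a ∷ b ∷ v) zero    _     = [] , a , b , v , refl , refl
  cut (a ∷ [])    zero    (s≤s ())
  cut (x ∷ w)     (suc q) 1+q<L with cut w q (s≤s⁻¹ 1+q<L)
  ... | u , a , b , v , refl , refl = x ∷ u , a , b , v , refl , refl

module _ {k : ℕ} (E : Fin k → Fin k → Set) where

  InE-sym : ∀ {i j} → InE E i j → InE E j i
  InE-sym (inj₁ e) = inj₂ e
  InE-sym (inj₂ e) = inj₁ e

  ≈-context : ∀ {x y} (u v : Word k) → E ⊢ x ≈ y → E ⊢ (u ++ x ++ v) ≈ (u ++ y ++ v)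
  ≈-context u v (cancel u' v' a) =
    subst₂ (E ⊢_≈_) (reassoc u' (a ∷ inv a ∷ v')) (reassoc u' v') (cancel (u ++ u') (v' ++ v) a)
    where
    reassoc : ∀ u' v' → (u ++ u') ++ v' ++ v ≡ u ++ (u' ++ v') ++ v
    reassoc u' v' = trans (++-assoc u u' (v' ++ v)) (cong (u ++_) (sym (++-assoc u' v' v)))
  ≈-context u v (comm u' v' i j ij) =
    subst₂ (E ⊢_≈_) (reassoc (gen i) (gen j)) (reassoc (gen j) (gen i)) (comm (u ++ u') (v' ++ v) i j ij)
    where
    reassoc : ∀ a b → (u ++ u') ++ a ∷ b ∷ v' ++ v ≡ u ++ (u' ++ a ∷ b ∷ v') ++ v
    reassoc a b = trans (++-assoc u u' _) (cong (u ++_) (sym (++-assoc u' (a ∷ b ∷ v') v)))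
  ≈-context u v ≈-refl          = ≈-refl
  ≈-context u v (≈-sym p)       = ≈-sym (≈-context u v p)
  ≈-context u v (≈-trans p q)   = ≈-trans (≈-context u v p) (≈-context u v q)

  -- The defining relations only commute generators; conjugating by g_i shows that g_i⁻¹
  -- commutes with g_j, and from this all four sign combinations follow.
  inverse-commutes : ∀ i j → InE E i j → E ⊢ ((i , false) ∷ gen j ∷ []) ≈ (gen j ∷ (i , false) ∷ [])
  inverse-commutes i j ij =
    ≈-trans (≈-sym (cancel ((i , false) ∷ gen j ∷ []) [] (gen i)))
    (≈-trans (comm ((i , false) ∷ []) ((i , false) ∷ []) j i (InE-sym ij))
             (cancel [] (gen j ∷ (i , false) ∷ []) (i , false)))

  independent-commute : ∀ a b → Independent E a b → E ⊢ (a ∷ b ∷ []) ≈ (b ∷ a ∷ [])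
  independent-commute (i , true)  (j , true)  ij = comm [] [] i j ij
  independent-commute (i , false) (j , true)  ij = inverse-commutes i j ij
  independent-commute (i , true)  (j , false) ij = ≈-sym (inverse-commutes j i (InE-sym ij))
  independent-commute (i , false) (j , false) ij =
    ≈-trans (≈-sym (cancel ((i , false) ∷ (j , false) ∷ []) [] (gen i)))
    (≈-trans (≈-context ((i , false) ∷ []) ((i , false) ∷ []) (inverse-commutes j i (InE-sym ij)))
             (cancel [] ((j , false) ∷ (i , false) ∷ []) (i , false)))

  commute : ∀ (u v : Word k) a b → Independent E a b → E ⊢ (u ++ a ∷ b ∷ v) ≈ (u ++ b ∷ a ∷ v)
  commute u v a b ab = ≈-context u v (independent-commute a b ab)

  -- It is a good perfect matching with positions in ℕ rather than Fin and with
  -- the crossing condition in the orientation-free form given by `crosses`.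
  record Pairing (d : Symbol k) (w : Word k) : Set where
    field
      match              : ℕ → ℕ
      match-<            : ∀ {n} → n < length w → match n < length w
      match-involutive   : ∀ {n} → n < length w → match (match n) ≡ n
      match-≢            : ∀ {n} → n < length w → match n ≢ n
      match-inverse      : ∀ {n} → n < length w → nth d w (match n) ≡ inv (nth d w n)
      crossing-independent : ∀ {x y} → x < length w → y < length w → y ≢ x → y ≢ match x →
        crosses x (match x) y (match y) ≡ true → Independent E (nth d w x) (nth d w y)

    match-injective : ∀ {x y} → x < length w → y < length w → match x ≡ match y → x ≡ y
    match-injective = involution-injective match match-involutive

  open Pairing

  empty-pairing : ∀ d → Pairing d []
  empty-pairing d = record
    { match = λ n → n ; match-< = λ () ; match-involutive = λ () ; match-≢ = λ ()
    ; match-inverse = λ () ; crossing-independent = λ () }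

  away-onPair : ∀ {m x} → Away m x → OnPair m x → ⊥
  away-onPair (x≢m , _)   (inj₁ x≡m)   = x≢m x≡m
  away-onPair (_ , x≢1+m) (inj₂ x≡1+m) = x≢1+m x≡1+m

  onPair-mate : ∀ {m z} → OnPair m z → OnPair m (swapAt m z)
  onPair-mate {m} (inj₁ refl) = inj₂ (swapAt-here m)
  onPair-mate {m} (inj₂ refl) = inj₁ (swapAt-there m)

  onPair-cases : ∀ {m z x} → OnPair m z → OnPair m x → x ≡ z ⊎ x ≡ swapAt m z
  onPair-cases {m} (inj₁ refl) (inj₁ refl) = inj₁ refl
  onPair-cases {m} (inj₂ refl) (inj₂ refl) = inj₁ refl
  onPair-cases {m} (inj₁ refl) (inj₂ refl) = inj₂ (sym (swapAt-here m))
  onPair-cases {m} (inj₂ refl) (inj₁ refl) = inj₂ (sym (swapAt-there m))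

  mate-≢ : ∀ {m z} → OnPair m z → swapAt m z ≢ z
  mate-≢ {m} (inj₁ refl) e = <-irrefl (sym (trans (sym (swapAt-here m)) e)) (n<1+n m)
  mate-≢ {m} (inj₂ refl) e = <-irrefl (trans (sym (swapAt-there m)) e) (n<1+n m)

  module Gap (d a b : Symbol k) (u v : Word k) where
    m : ℕ
    m = length u

    W : Word k
    W = u ++ a ∷ b ∷ v

    W' : Word k
    W' = u ++ v

    onPair-< : ∀ {z} → OnPair m z → z < length W
    onPair-< (inj₁ refl) = here-< a b u v
    onPair-< (inj₂ refl) = there-< a b u v

    skip-<W : ∀ {n} → n < length W' → skip m n < length W
    skip-<W {n} n<L = subst (skip m n <_) (sym (length-insert a b u v)) (skip-< m n<L)

    unskip-<W' : ∀ {x} → Away m x → x < length W → unskip m x < length W'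
    unskip-<W' {x} ax x<L =
      unskip-< m (subst (m ≤_) (sym (length-++ u)) (m≤m+n m (length v))) ax
        (subst (x <_) (length-insert a b u v) x<L)

    nth-W' : ∀ n → nth d W' n ≡ nth d W (skip m n)
    nth-W' = nth-skip d a b u v

    nth-unskip : ∀ {x} → Away m x → nth d W' (unskip m x) ≡ nth d W x
    nth-unskip {x} ax = trans (nth-W' (unskip m x)) (cong (nth d W) (skip-unskip m x ax))

  mate-letter : ∀ d a (u v : Word k) {z} → OnPair (length u) z →
    nth d (u ++ a ∷ inv a ∷ v) (swapAt (length u) z) ≡ inv (nth d (u ++ a ∷ inv a ∷ v) z)
  mate-letter d a u v (inj₁ refl) =
    trans (cong (nth d (u ++ a ∷ inv a ∷ v)) (swapAt-here (length u)))
      (trans (nth-there d a (inv a) u v) (cong inv (sym (nth-here d a (inv a) u v))))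
  mate-letter d a u v (inj₂ refl) =
    trans (cong (nth d (u ++ a ∷ inv a ∷ v)) (swapAt-there (length u))) (trans (nth-here d a (inv a) u v)
      (trans (sym (inv-involutive a)) (cong inv (sym (nth-there d a (inv a) u v)))))

  -- Cancelling a a⁻¹ at positions m, m+1.  The old partners of these two letters carry a⁻¹
  -- and a; they become partners of each other (`merged`), and the remaining positions are
  -- renumbered by `unskip m`.  A chord crossing a merged chord crossed one of the two old
  -- chords (crosses-split), whose letters have the same generator.
  module Delete (d a : Symbol k) (u v : Word k) (N : Pairing d (u ++ a ∷ inv a ∷ v)) where
    open Gap d a (inv a) u v
    p : ℕ → ℕ
    p = match N
    L : ℕ
    L = length W
    f : ℕ → Symbol k
    f = nth d W

    merged : ℕ → ℕ
    merged y with away? m (p y)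
    ... | inj₁ _ = p y
    ... | inj₂ _ = p (swapAt m (p y))

    merged-away : ∀ {y} → Away m (p y) → merged y ≡ p y
    merged-away {y} apy with away? m (p y)
    ... | inj₁ _   = refl
    ... | inj₂ opy = ⊥-elim (away-onPair apy opy)

    merged-onPair : ∀ {y} → OnPair m (p y) → merged y ≡ p (swapAt m (p y))
    merged-onPair {y} opy with away? m (p y)
    ... | inj₁ apy = ⊥-elim (away-onPair apy opy)
    ... | inj₂ _   = refl

    module AtPair {y} (y<L : y < L) (ay : Away m y) (opy : OnPair m (p y)) where
      z' : ℕ
      z' = swapAt m (p y)

      oz' : OnPair m z'
      oz' = onPair-mate opy

      z'<L : z' < L
      z'<L = onPair-< oz'

      mate-is-y-letter : f z' ≡ f y
      mate-is-y-letter = trans (mate-letter d a u v opy)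
        (trans (cong inv (match-inverse N y<L)) (inv-involutive (f y)))

      -- The partner of the mate cannot lie on the pair: it is neither y nor the mate itself.
      partner-mate-away : Away m (p z')
      partner-mate-away with away? m (p z')
      ... | inj₁ a' = a'
      ... | inj₂ o with onPair-cases opy o
      ...   | inj₁ e = ⊥-elim (away-onPair ay (subst (OnPair m) (match-injective N z'<L y<L e) oz'))
      ...   | inj₂ e = ⊥-elim (match-≢ N z'<L e)

      merged-involutive : merged (merged y) ≡ y
      merged-involutive = begin
        merged (merged y)                    ≡⟨ cong merged (merged-onPair {y} opy) ⟩
        merged (p z')
          ≡⟨ merged-onPair (subst (OnPair m) (sym (match-involutive N z'<L)) oz') ⟩
        p (swapAt m (p (p z')))              ≡⟨ cong (λ x → p (swapAt m x)) (match-involutive N z'<L) ⟩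
        p (swapAt m z')                      ≡⟨ cong p (swapAt-involutive m (p y)) ⟩
        p (p y)                              ≡⟨ match-involutive N y<L ⟩
        y ∎

      crossing-merged-away : ∀ {y'} → y' < L → Away m y' → Away m (p y') → y' ≢ y → y' ≢ merged y →
        crosses y (merged y) y' (p y') ≡ true → Independent E (f y) (f y')
      crossing-merged-away {y'} y'<L ay' apy' y'≢y y'≢my hX
        rewrite merged-onPair {y} opy
              | crosses-split y (p z') y' (p y') (p y) z' (onPair-<ᵇ opy oz' ay') (onPair-<ᵇ opy oz' apy')
        with xor-true (crosses y (p y) y' (p y')) (crosses z' (p z') y' (p y')) hX
      ... | inj₁ hX₁ = crossing-independent N y<L y'<L y'≢y
                         (λ e → away-onPair ay' (subst (OnPair m) (sym e) opy)) hX₁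
      ... | inj₂ hX₂ = subst (λ s → Independent E s (f y')) mate-is-y-letter
              (crossing-independent N z'<L y'<L (λ e → away-onPair ay' (subst (OnPair m) (sym e) oz'))
                y'≢my hX₂)

      merged-≢ : merged y ≢ y
      merged-≢ e = mate-≢ opy (match-injective N z'<L (match-< N y<L)
                     (trans (trans (sym (merged-onPair {y} opy)) e) (sym (match-involutive N y<L))))

    module AtAway {y} (y<L : y < L) (ay : Away m y) where
      by-cases : {P : Set} → (Away m (p y) → P) → (OnPair m (p y) → P) → P
      by-cases away pair = [ away , pair ]′ (away? m (p y))

      merged-< : merged y < L
      merged-< = by-cases
        (λ apy → subst (_< L) (sym (merged-away apy)) (match-< N y<L))
        (λ opy → subst (_< L) (sym (merged-onPair opy)) (match-< N (AtPair.z'<L y<L ay opy)))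

      merged-away-point : Away m (merged y)
      merged-away-point = by-cases
        (λ apy → subst (Away m) (sym (merged-away apy)) apy)
        (λ opy → subst (Away m) (sym (merged-onPair opy)) (AtPair.partner-mate-away y<L ay opy))

      merged-involutive : merged (merged y) ≡ y
      merged-involutive = by-cases via-away (AtPair.merged-involutive y<L ay)
        where
        via-away : Away m (p y) → merged (merged y) ≡ y
        via-away apy = begin
          merged (merged y) ≡⟨ cong merged (merged-away apy) ⟩
          merged (p y)      ≡⟨ merged-away (subst (Away m) (sym (match-involutive N y<L)) ay) ⟩
          p (p y)           ≡⟨ match-involutive N y<L ⟩
          y ∎

      merged-≢ : merged y ≢ y
      merged-≢ = by-cases
        (λ apy e → match-≢ N y<L (trans (sym (merged-away apy)) e))
        (AtPair.merged-≢ y<L ay)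

      merged-inverse : f (merged y) ≡ inv (f y)
      merged-inverse = by-cases
        (λ apy → trans (cong f (merged-away apy)) (match-inverse N y<L))
        (λ opy → let open AtPair y<L ay opy in
          trans (cong f (merged-onPair opy)) (trans (match-inverse N z'<L) (cong inv mate-is-y-letter)))

    crossing-merged : ∀ {x y} → x < L → y < L → Away m x → Away m y → y ≢ x → y ≢ merged x →
      crosses x (merged x) y (merged y) ≡ true → Independent E (f x) (f y)
    crossing-merged {x} {y} x<L y<L ax ay y≢x y≢mx hX = cases (away? m (p x)) (away? m (p y))
      where
      open AtAway using (merged-involutive)
      cases : Away m (p x) ⊎ OnPair m (p x) → Away m (p y) ⊎ OnPair m (p y) → Independent E (f x) (f y)
      cases (inj₂ opx) (inj₂ opy) with onPair-cases opx opy
      ... | inj₁ e = ⊥-elim (y≢x (match-injective N y<L x<L e))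
      ... | inj₂ e = ⊥-elim (y≢mx (trans (sym (match-involutive N y<L))
                       (trans (cong p e) (sym (merged-onPair {x} opx)))))
      cases (inj₂ opx) (inj₁ apy) =
        AtPair.crossing-merged-away x<L ax opx y<L ay apy y≢x y≢mx
          (trans (cong (crosses x (merged x) y) (sym (merged-away apy))) hX)
      cases (inj₁ apx) (inj₂ opy) =
        InE-sym (AtPair.crossing-merged-away y<L ay opy x<L ax apx (λ e → y≢x (sym e)) x≢my
          (trans (trans (cong (crosses y (merged y) x) (sym (merged-away apx)))
            (crosses-sym (λ e → y≢x (sym e)) x≢my (λ e → y≢mx (sym e)) (λ e → my≢mx (sym e)))) hX))
        where
        x≢my : x ≢ merged y
        x≢my e = y≢mx (trans (sym (merged-involutive y<L ay)) (cong merged (sym e)))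
        my≢mx : merged y ≢ merged x
        my≢mx e = y≢x (trans (sym (merged-involutive y<L ay)) (trans (cong merged e) (merged-involutive x<L ax)))
      cases (inj₁ apx) (inj₁ apy) =
        crossing-independent N x<L y<L y≢x (λ e → y≢mx (trans e (sym (merged-away apx))))
          (trans (cong₂ (λ s t → crosses x s y t) (sym (merged-away apx)) (sym (merged-away apy))) hX)

    restricted : ℕ → ℕ
    restricted n = unskip m (merged (skip m n))

    module AtSkip {n} (n<L : n < length W') = AtAway (skip-<W n<L) (skip-away m n)

    skip-restricted : ∀ {n} → n < length W' → skip m (restricted n) ≡ merged (skip m n)
    skip-restricted n<L = skip-unskip m _ (AtSkip.merged-away-point n<L)

    pairing : Pairing d W'
    pairing = record
      { match              = restricted
      ; match-<            = λ n<L → unskip-<W' (AtSkip.merged-away-point n<L) (AtSkip.merged-< n<L)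
      ; match-involutive   = λ {n} n<L → begin
          unskip m (merged (skip m (restricted n))) ≡⟨ cong (λ s → unskip m (merged s)) (skip-restricted n<L) ⟩
          unskip m (merged (merged (skip m n)))     ≡⟨ cong (unskip m) (AtSkip.merged-involutive n<L) ⟩
          unskip m (skip m n)                       ≡⟨ unskip-skip m n ⟩
          n ∎
      ; match-≢            = λ n<L e → AtSkip.merged-≢ n<L (trans (sym (skip-restricted n<L)) (cong (skip m) e))
      ; match-inverse      = λ {n} n<L → begin
          nth d W' (restricted n)       ≡⟨ nth-unskip (AtSkip.merged-away-point n<L) ⟩
          f (merged (skip m n))         ≡⟨ AtSkip.merged-inverse n<L ⟩
          inv (f (skip m n))            ≡⟨ cong inv (sym (nth-W' n)) ⟩
          inv (nth d W' n) ∎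
      ; crossing-independent = λ {x} {y} x<L y<L y≢x y≢px hX →
          subst₂ (Independent E) (sym (nth-W' x)) (sym (nth-W' y))
            (crossing-merged (skip-<W x<L) (skip-<W y<L) (skip-away m x) (skip-away m y)
              (λ e → y≢x (skip-injective m e))
              (λ e → y≢px (skip-injective m (trans e (sym (skip-restricted x<L)))))
              (trans (sym (cong₂ (λ s t → crosses (skip m x) s (skip m y) t)
                                 (skip-restricted x<L) (skip-restricted y<L)))
                (trans (skip-crosses m x (restricted x) y (restricted y)) hX)))
      }

  -- Inserting a a⁻¹ at positions m, m+1: the two new letters become partners, and the
  -- old chords are renumbered by `skip m`.  The new chord crosses nothing.
  module Insert (d a : Symbol k) (u v : Word k) (N : Pairing d (u ++ v)) where
    open Gap d a (inv a) u v
    q : ℕ → ℕ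
    q = match N
    L : ℕ
    L = length W
    f : ℕ → Symbol k
    f = nth d W

    extended : ℕ → ℕ
    extended x with away? m x
    ... | inj₁ _ = skip m (q (unskip m x))
    ... | inj₂ _ = swapAt m x

    extended-away : ∀ {x} → Away m x → extended x ≡ skip m (q (unskip m x))
    extended-away {x} ax with away? m x
    ... | inj₁ _  = refl
    ... | inj₂ ox = ⊥-elim (away-onPair ax ox)

    extended-onPair : ∀ {x} → OnPair m x → extended x ≡ swapAt m x
    extended-onPair {x} ox with away? m x
    ... | inj₁ ax = ⊥-elim (away-onPair ax ox)
    ... | inj₂ _  = refl

    module AtAway {x} (x<L : x < L) (ax : Away m x) where
      n : ℕ
      n = unskip m x

      n<L' : n < length W'
      n<L' = unskip-<W' ax x<L

      x≡skip : skip m n ≡ x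
      x≡skip = skip-unskip m x ax

      extended-away-point : Away m (extended x)
      extended-away-point = subst (Away m) (sym (extended-away ax)) (skip-away m (q n))

      extended-< : extended x < L
      extended-< = subst (_< L) (sym (extended-away ax)) (skip-<W (match-< N n<L'))

      extended-involutive : extended (extended x) ≡ x
      extended-involutive = begin
        extended (extended x)                 ≡⟨ cong extended (extended-away ax) ⟩
        extended (skip m (q n))               ≡⟨ extended-away (skip-away m (q n)) ⟩
        skip m (q (unskip m (skip m (q n))))  ≡⟨ cong (λ s → skip m (q s)) (unskip-skip m (q n)) ⟩
        skip m (q (q n))                      ≡⟨ cong (skip m) (match-involutive N n<L') ⟩
        skip m n                              ≡⟨ x≡skip ⟩
        x ∎

      extended-≢ : extended x ≢ x
      extended-≢ e = match-≢ N n<L' (skip-injective m (trans (trans (sym (extended-away ax)) e) (sym x≡skip)))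

      extended-inverse : f (extended x) ≡ inv (f x)
      extended-inverse = begin
        f (extended x)        ≡⟨ cong f (extended-away ax) ⟩
        f (skip m (q n))      ≡⟨ sym (nth-W' (q n)) ⟩
        nth d W' (q n)        ≡⟨ match-inverse N n<L' ⟩
        inv (nth d W' n)      ≡⟨ cong inv (nth-unskip ax) ⟩
        inv (f x) ∎

    module AtPair {x} (ox : OnPair m x) where
      extended-onPair-point : OnPair m (extended x)
      extended-onPair-point = subst (OnPair m) (sym (extended-onPair ox)) (onPair-mate ox)

      extended-involutive : extended (extended x) ≡ x
      extended-involutive = begin
        extended (extended x)  ≡⟨ cong extended (extended-onPair ox) ⟩
        extended (swapAt m x)  ≡⟨ extended-onPair (onPair-mate ox) ⟩
        swapAt m (swapAt m x)  ≡⟨ swapAt-involutive m x ⟩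
        x ∎

    by-cases : ∀ {P : Set} x → (Away m x → P) → (OnPair m x → P) → P
    by-cases x away pair = [ away , pair ]′ (away? m x)

    crossing-extended : ∀ {x y} → x < L → y < L → y ≢ x → y ≢ extended x →
      crosses x (extended x) y (extended y) ≡ true → Independent E (f x) (f y)
    crossing-extended {x} {y} x<L y<L y≢x y≢ex hX = cases (away? m x) (away? m y)
      where
      nothing : crosses x (extended x) y (extended y) ≡ false → Independent E (f x) (f y)
      nothing e = ⊥-elim (false≢true (trans (sym e) hX))
      cases : Away m x ⊎ OnPair m x → Away m y ⊎ OnPair m y → Independent E (f x) (f y)
      cases (inj₂ ox) (inj₂ oy) with onPair-cases ox oy
      ... | inj₁ e = ⊥-elim (y≢x e)
      ... | inj₂ e = ⊥-elim (y≢ex (trans e (sym (extended-onPair ox))))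
      cases (inj₂ ox) (inj₁ ay) = nothing (proj₁ (onPair-crosses-nothing ox (AtPair.extended-onPair-point ox)
                                    ay (AtAway.extended-away-point y<L ay)))
      cases (inj₁ ax) (inj₂ oy) = nothing (proj₂ (onPair-crosses-nothing oy (AtPair.extended-onPair-point oy)
                                    ax (AtAway.extended-away-point x<L ax)))
      cases (inj₁ ax) (inj₁ ay) =
        subst₂ (Independent E) (nth-unskip ax) (nth-unskip ay)
          (crossing-independent N X.n<L' Y.n<L'
            (λ e → y≢x (trans (sym Y.x≡skip) (trans (cong (skip m) e) X.x≡skip)))
            (λ e → y≢ex (trans (sym Y.x≡skip) (trans (cong (skip m) e) (sym (extended-away ax)))))
            (trans (sym (skip-crosses m X.n (q X.n) Y.n (q Y.n)))
              (trans (cong₂ (λ s t → crosses s (skip m (q X.n)) t (skip m (q Y.n))) X.x≡skip Y.x≡skip)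
                (trans (cong₂ (λ s t → crosses x s y t) (sym (extended-away ax)) (sym (extended-away ay))) hX))))
        where
        module X = AtAway x<L ax
        module Y = AtAway y<L ay

    pairing : Pairing d W
    pairing = record
      { match              = extended
      ; match-<            = λ {x} x<L → by-cases x (AtAway.extended-< x<L)
                               (λ ox → onPair-< (AtPair.extended-onPair-point ox))
      ; match-involutive   = λ {x} x<L → by-cases x (AtAway.extended-involutive x<L) AtPair.extended-involutive
      ; match-≢            = λ {x} x<L → by-cases x (AtAway.extended-≢ x<L)
                               (λ ox e → mate-≢ ox (trans (sym (extended-onPair ox)) e))
      ; match-inverse      = λ {x} x<L → by-cases x (AtAway.extended-inverse x<L)
                               (λ ox → trans (cong f (extended-onPair ox)) (mate-letter d a u v ox))
      ; crossing-independent = crossing-extended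
      }

  -- Crossings between chords are unchanged unless both chords end
  -- on the pair, and then their letters have the generators of a and b, which are independent.
  module Swap (d a b : Symbol k) (u v : Word k) (ab : Independent E a b) (N : Pairing d (u ++ a ∷ b ∷ v)) where
    p : ℕ → ℕ
    p = match N
    m : ℕ
    m = length u
    W : Word k
    W = u ++ a ∷ b ∷ v
    W' : Word k
    W' = u ++ b ∷ a ∷ v
    L : ℕ
    L = length W
    f : ℕ → Symbol k
    f = nth d W

    -- Independence only depends on generators, and the two ends of a chord carry the same
    -- generator.  `PairEnd A z`: z is an endpoint of the chord at A lying on the pair.
    PairEnd : ℕ → ℕ → Set
    PairEnd A z = OnPair m z × (z ≡ A ⊎ z ≡ p A)

    chord-cases : ∀ A → (Away m A × Away m (p A)) ⊎ Σ ℕ (PairEnd A)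
    chord-cases A with away? m A | away? m (p A)
    ... | inj₁ aA | inj₁ apA = inj₁ (aA , apA)
    ... | inj₂ oA | _        = inj₂ (A , oA , inj₁ refl)
    ... | inj₁ _  | inj₂ opA = inj₂ (p A , opA , inj₂ refl)

    pairEnd-generator : ∀ {A z} → A < L → PairEnd A z → proj₁ (f z) ≡ proj₁ (f A)
    pairEnd-generator A<L (_ , inj₁ refl) = refl
    pairEnd-generator A<L (_ , inj₂ refl) = cong proj₁ (match-inverse N A<L)

    pairEnds-distinct : ∀ {A C z z'} → A < L → C < L → C ≢ A → C ≢ p A →
      PairEnd A z → PairEnd C z' → z ≢ z'
    pairEnds-distinct A<L C<L C≢A C≢pA (_ , inj₁ refl) (_ , inj₁ refl) e = C≢A (sym e)
    pairEnds-distinct A<L C<L C≢A C≢pA (_ , inj₁ refl) (_ , inj₂ refl) e =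
      C≢pA (trans (sym (match-involutive N C<L)) (cong p (sym e)))
    pairEnds-distinct A<L C<L C≢A C≢pA (_ , inj₂ refl) (_ , inj₁ refl) e = C≢pA (sym e)
    pairEnds-distinct A<L C<L C≢A C≢pA (_ , inj₂ refl) (_ , inj₂ refl) e =
      C≢A (trans (sym (match-involutive N C<L)) (trans (cong p (sym e)) (match-involutive N A<L)))

    pair-independent : ∀ {z z'} → OnPair m z → OnPair m z' → z ≢ z' → Independent E (f z) (f z')
    pair-independent (inj₁ refl) (inj₁ refl) z≢z' = ⊥-elim (z≢z' refl)
    pair-independent (inj₂ refl) (inj₂ refl) z≢z' = ⊥-elim (z≢z' refl)
    pair-independent (inj₁ refl) (inj₂ refl) _ =
      subst₂ (Independent E) (sym (nth-here d a b u v)) (sym (nth-there d a b u v)) ab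
    pair-independent (inj₂ refl) (inj₁ refl) _ =
      subst₂ (Independent E) (sym (nth-there d a b u v)) (sym (nth-here d a b u v)) (InE-sym ab)

    crossing-swapped : ∀ {A C} → A < L → C < L → C ≢ A → C ≢ p A →
      crosses (swapAt m A) (swapAt m (p A)) (swapAt m C) (swapAt m (p C)) ≡ true → Independent E (f A) (f C)
    crossing-swapped {A} {C} A<L C<L C≢A C≢pA hX with chord-cases A | chord-cases C
    ... | inj₁ awayA | _ =
      crossing-independent N A<L C<L C≢A C≢pA (trans (sym (swapAt-crosses m A (p A) C (p C) (inj₁ awayA))) hX)
    ... | inj₂ _ | inj₁ awayC =
      crossing-independent N A<L C<L C≢A C≢pA (trans (sym (swapAt-crosses m A (p A) C (p C) (inj₂ awayC))) hX)
    ... | inj₂ (z , endA) | inj₂ (z' , endC) =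
      subst₂ (InE E) (pairEnd-generator A<L endA) (pairEnd-generator C<L endC)
        (pair-independent (proj₁ endA) (proj₁ endC) (pairEnds-distinct A<L C<L C≢A C≢pA endA endC))

    swapped : ℕ → ℕ
    swapped n = swapAt m (p (swapAt m n))

    length-W' : length W' ≡ L
    length-W' = length-swap a b u v

    swapAt-<W : ∀ {n} → n < length W' → swapAt m n < L
    swapAt-<W n<L = swapAt-< m (subst (_ <_) length-W' n<L) (there-< a b u v)

    nth-W' : ∀ n → nth d W' n ≡ f (swapAt m n)
    nth-W' = nth-swapAt d a b u v

    pairing : Pairing d W'
    pairing = record
      { match              = swapped
      ; match-<            = λ n<L → subst (_ <_) (sym length-W')
                               (swapAt-< m (match-< N (swapAt-<W n<L)) (there-< a b u v))
      ; match-involutive   = λ {n} n<L → begin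
          swapAt m (p (swapAt m (swapAt m (p (swapAt m n)))))
            ≡⟨ cong (λ s → swapAt m (p s)) (swapAt-involutive m _) ⟩
          swapAt m (p (p (swapAt m n)))
            ≡⟨ cong (swapAt m) (match-involutive N (swapAt-<W n<L)) ⟩
          swapAt m (swapAt m n)
            ≡⟨ swapAt-involutive m n ⟩
          n ∎
      ; match-≢            = λ n<L e → match-≢ N (swapAt-<W n<L)
                               (trans (sym (swapAt-involutive m _)) (cong (swapAt m) e))
      ; match-inverse      = λ {n} n<L → begin
          nth d W' (swapped n)              ≡⟨ nth-W' (swapped n) ⟩
          f (swapAt m (swapped n))          ≡⟨ cong f (swapAt-involutive m _) ⟩
          f (p (swapAt m n))                ≡⟨ match-inverse N (swapAt-<W n<L) ⟩
          inv (f (swapAt m n))              ≡⟨ cong inv (sym (nth-W' n)) ⟩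
          inv (nth d W' n) ∎
      ; crossing-independent = λ {x} {y} x<L y<L y≢x y≢px hX →
          subst₂ (Independent E) (sym (nth-W' x)) (sym (nth-W' y))
            (crossing-swapped (swapAt-<W x<L) (swapAt-<W y<L)
              (λ e → y≢x (swapAt-injective m e))
              (λ e → y≢px (trans (sym (swapAt-involutive m y)) (cong (swapAt m) e)))
              (trans (cong₂ (λ s t → crosses s (swapped x) t (swapped y))
                            (swapAt-involutive m x) (swapAt-involutive m y)) hX))
      }

  pairing-invariant : ∀ d {w w'} → E ⊢ w ≈ w' →
    (Pairing d w → Pairing d w') × (Pairing d w' → Pairing d w)
  pairing-invariant d (cancel u v a)    = Delete.pairing d a u v , Insert.pairing d a u v
  pairing-invariant d (comm u v i j ij) =
    Swap.pairing d (gen i) (gen j) u v ij , Swap.pairing d (gen j) (gen i) u v (InE-sym ij)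
  pairing-invariant d ≈-refl            = (λ N → N) , (λ N → N)
  pairing-invariant d (≈-sym p)         = proj₂ (pairing-invariant d p) , proj₁ (pairing-invariant d p)
  pairing-invariant d (≈-trans p q)     =
    (λ N → proj₁ (pairing-invariant d q) (proj₁ (pairing-invariant d p) N)) ,
    (λ N → proj₂ (pairing-invariant d p) (proj₂ (pairing-invariant d q) N))

  trivial⇒pairing : ∀ d w → IsTrivial E w → Pairing d w
  trivial⇒pairing d w w≈[] = proj₂ (pairing-invariant d w≈[]) (empty-pairing d)

  Reduct : Symbol k → Word k → Set
  Reduct d w = Σ (Word k) λ w' → Pairing d w' × (length w ≡ suc (suc (length w'))) × (E ⊢ w ≈ w')

  cancel-adjacent : ∀ d u a b v → b ≡ inv a → Pairing d (u ++ a ∷ b ∷ v) → Reduct d (u ++ a ∷ b ∷ v)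
  cancel-adjacent d u a .(inv a) v refl N =
    u ++ v , Delete.pairing d a u v N , length-insert a (inv a) u v , cancel u v a

  CancellableChord : ∀ d (w : Word k) → Pairing d w → ℕ → ℕ → Set
  CancellableChord d w N q r = suc q + r < length w × match N q ≡ suc q + r ×
    (∀ x → q < x → x < suc q + r → Independent E (nth d w q) (nth d w x))

  -- Such a chord can be cancelled: the letter at q commutes rightwards until it is adjacent
  -- to its partner.
  cancel-chord : ∀ d (w : Word k) (N : Pairing d w) q r → CancellableChord d w N q r → Reduct d w
  cancel-chord d w N q r (j<L , _) with cut w q (≤-<-trans (s≤s (m≤m+n q r)) j<L)
  cancel-chord d _ N _ zero (_ , q↦j , _) | u , a , b , v , refl , refl =
    cancel-adjacent d u a b v partner-letter N
    where
    partner-letter : b ≡ inv a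
    partner-letter = begin
      b                                       ≡⟨ sym (nth-there d a b u v) ⟩
      nth d (u ++ a ∷ b ∷ v) (suc (length u))
        ≡⟨ cong (nth d (u ++ a ∷ b ∷ v)) (sym (trans q↦j (cong suc (+-identityʳ (length u))))) ⟩
      nth d (u ++ a ∷ b ∷ v) (match N (length u)) ≡⟨ match-inverse N (here-< a b u v) ⟩
      inv (nth d (u ++ a ∷ b ∷ v) (length u)) ≡⟨ cong inv (nth-here d a b u v) ⟩
      inv a ∎
  cancel-chord d _ N _ (suc r) (j<L , q↦j , inner) | u , a , b , v , refl , refl =
    let w' , N' , len , w≈w' = cancel-chord d (u ++ b ∷ a ∷ v) (Swap.pairing d a b u v ab N) (suc m) r
                                 (j<L' , q↦j' , inner')
    in  w' , N' , trans (length-swap b a u v) len , ≈-trans (commute u v a b ab) w≈w'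
    where
    m : ℕ
    m = length u
    j : ℕ
    j = suc m + suc r
    j≡ : j ≡ suc (suc m) + r
    j≡ = cong suc (+-suc m r)
    ab : Independent E a b
    ab = subst₂ (Independent E) (nth-here d a b u v) (nth-there d a b u v)
           (inner (suc m) (n<1+n m) (subst (suc m <_) (sym j≡) (s≤s (s≤s (m≤m+n m r)))))
    j<L' : suc (suc m) + r < length (u ++ b ∷ a ∷ v)
    j<L' = subst₂ _<_ j≡ (sym (length-swap a b u v)) j<L
    q↦j' : match (Swap.pairing d a b u v ab N) (suc m) ≡ suc (suc m) + r
    q↦j' = begin
      swapAt m (match N (swapAt m (suc m))) ≡⟨ cong (λ s → swapAt m (match N s)) (swapAt-there m) ⟩
      swapAt m (match N m)                  ≡⟨ cong (swapAt m) (trans q↦j j≡) ⟩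
      swapAt m (suc (suc m) + r)            ≡⟨ swapAt-away m _ (beyond-away (s≤s (s≤s (m≤m+n m r)))) ⟩
      suc (suc m) + r ∎
    inner' : ∀ x → suc m < x → x < suc (suc m) + r →
      Independent E (nth d (u ++ b ∷ a ∷ v) (suc m)) (nth d (u ++ b ∷ a ∷ v) x)
    inner' x 1+m<x x<j = subst₂ (Independent E)
      (sym (trans (nth-swapAt d a b u v (suc m)) (cong (nth d (u ++ a ∷ b ∷ v)) (swapAt-there m))))
      (sym (trans (nth-swapAt d a b u v x) (cong (nth d (u ++ a ∷ b ∷ v)) (swapAt-away m x (beyond-away 1+m<x)))))
      (inner x (<-trans (n<1+n m) 1+m<x) (subst (x <_) (sym j≡) x<j))

  -- In a nonempty word, the first position j whose partner q lies to its left closes an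
  -- innermost chord: every position strictly inside (q, j) is matched outside it, so its
  -- chord crosses (q, j) and its letter is independent of the letter at q.
  innermost-chord : ∀ d (w : Word k) (N : Pairing d w) → 0 < length w →
    Σ ℕ λ q → Σ ℕ λ r → CancellableChord d w N q r
  innermost-chord d w N 0<L =
    let j , j≤p0 , q<j , first = least-witness (λ n → p n <? n) closes-at-first
    in  chord-at j (≤-<-trans j≤p0 (match-< N 0<L)) q<j first
    where
    p : ℕ → ℕ
    p = match N

    closes-at-first : p (p 0) < p 0
    closes-at-first =
      subst (_< p 0) (sym (match-involutive N 0<L)) (≤∧≢⇒< z≤n (λ e → match-≢ N 0<L (sym e)))

    chord-at : ∀ j → j < length w → p j < j → (∀ x → x < j → ¬ p x < x) →
      Σ ℕ λ q → Σ ℕ λ r → CancellableChord d w N q r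
    chord-at j j<L q<j first = q , j ∸ suc q , subst (_< length w) (sym q+r≡j) j<L ,
                               trans q↦j (sym q+r≡j) , λ x q<x x<j → inner x q<x (subst (x <_) q+r≡j x<j)
      where
      q : ℕ
      q = p j
      q+r≡j : suc q + (j ∸ suc q) ≡ j
      q+r≡j = m+[n∸m]≡n q<j
      q↦j : p q ≡ j
      q↦j = match-involutive N j<L
      inner : ∀ x → q < x → x < j → Independent E (nth d w q) (nth d w x)
      inner x q<x x<j = crossing-independent N (<-trans q<j j<L) x<L (λ e → <-irrefl (sym e) q<x)
                          (λ e → <-irrefl (trans e q↦j) x<j)
                          (subst (λ s → crosses q s x (p x) ≡ true) (sym q↦j) hX)
        where
        x<L : x < length w
        x<L = <-trans x<j j<L
        x<px : x < p x
        x<px = ≤∧≢⇒< (≮⇒≥ (first x x<j)) (λ e → match-≢ N x<L (sym e))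
        j<px : j < p x
        j<px = ≤∧≢⇒< (≮⇒≥ (λ px<j → first (p x) px<j
                             (subst (_< p x) (sym (match-involutive N x<L)) x<px)))
                      (λ e → <-irrefl (match-injective N (<-trans q<j j<L) x<L (trans q↦j e)) q<x)
        hX : crosses q j x (p x) ≡ true
        hX = interleaved⇒crosses q<x x<j j<px

  pairing⇒trivial : ∀ d n (w : Word k) → length w ≤ n → Pairing d w → IsTrivial E w
  pairing⇒trivial d n       []        _       _ = ≈-refl
  pairing⇒trivial d (suc n) w@(_ ∷ _) |w|≤1+n N =
    let q , r , cancellable = innermost-chord d w N (s≤s z≤n)
        w' , N' , |w|≡2+|w'| , w≈w' = cancel-chord d w N q r cancellable
    in  ≈-trans w≈w' (pairing⇒trivial d n w'
          (≤-trans (n≤1+n _) (s≤s⁻¹ (subst (_≤ suc n) |w|≡2+|w'| |w|≤1+n))) N')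

  -- The crossing condition of a pairing follows from its instances with the chords in
  -- standard position x < y < p x < p y: reversing a chord or exchanging the two chords does
  -- not change whether they cross, nor the generators involved.
  module FromOrdered (d : Symbol k) (w : Word k) (p : ℕ → ℕ)
    (p-involutive : ∀ {n} → n < length w → p (p n) ≡ n)
    (p-< : ∀ {n} → n < length w → p n < length w)
    (p-≢ : ∀ {n} → n < length w → p n ≢ n)
    (p-inverse : ∀ {n} → n < length w → nth d w (p n) ≡ inv (nth d w n))
    (ordered : ∀ {x y} → x < length w → y < length w → x < y → y < p x → p x < p y →
               Independent E (nth d w x) (nth d w y)) where

    L : ℕ
    L = length w

    same-generator : ∀ {n} → n < L → proj₁ (nth d w (p n)) ≡ proj₁ (nth d w n)
    same-generator n<L = cong proj₁ (p-inverse n<L)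

    distinct-partners : ∀ {x y} → x < L → y < L → y ≢ x → p x ≢ p y
    distinct-partners x<L y<L y≢x e = y≢x (involution-injective p p-involutive y<L x<L (sym e))

    below-partner : ∀ {n} → n < L → ¬ n < p n → p n < p (p n)
    below-partner n<L n≮pn = subst (p _ <_) (sym (p-involutive n<L)) (≤∧≢⇒< (≮⇒≥ n≮pn) (p-≢ n<L))

    crossing-oriented : ∀ {x y} → x < L → y < L → x < p x → y < p y → y ≢ x → y ≢ p x →
      crosses x (p x) y (p y) ≡ true → Independent E (nth d w x) (nth d w y)
    crossing-oriented {x} {y} x<L y<L x<px y<py y≢x y≢px hX with x <? y
    ... | yes x<y = let y<px , px<py = crosses⇒interleaved y<py px≢py x<y hX
                    in  ordered x<L y<L x<y y<px px<py
      where
      px≢py : p x ≢ p y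
      px≢py = distinct-partners x<L y<L y≢x
    ... | no x≮y  = let x<py , py<px = crosses⇒interleaved x<px (λ e → px≢py (sym e)) y<x hX'
                    in  InE-sym (ordered y<L x<L y<x x<py py<px)
      where
      y<x : y < x
      y<x = ≤∧≢⇒< (≮⇒≥ x≮y) y≢x
      px≢py : p x ≢ p y
      px≢py = distinct-partners x<L y<L y≢x
      hX' : crosses y (p y) x (p x) ≡ true
      hX' = trans (sym (crosses-sym y≢x y≢px (λ e → y≢px (trans (sym (p-involutive y<L)) (cong p e)))
                                    (λ e → px≢py (sym e)))) hX

    crossing-left-oriented : ∀ {x y} → x < L → y < L → x < p x → y ≢ x → y ≢ p x →
      crosses x (p x) y (p y) ≡ true → Independent E (nth d w x) (nth d w y)
    crossing-left-oriented {x} {y} x<L y<L x<px y≢x y≢px hX with y <? p y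
    ... | yes y<py = crossing-oriented x<L y<L x<px y<py y≢x y≢px hX
    ... | no y≮py  = subst₂ (InE E) refl (same-generator y<L)
        (crossing-oriented x<L (p-< y<L) x<px (below-partner y<L y≮py)
          (λ e → y≢px (trans (sym (p-involutive y<L)) (cong p e)))
          (λ e → distinct-partners x<L y<L y≢x (sym e))
          (trans (trans (cong (crosses x (p x) (p y)) (p-involutive y<L)) (crosses-flipʳ x (p x) (p y) y)) hX))

    crossing : ∀ {x y} → x < L → y < L → y ≢ x → y ≢ p x →
      crosses x (p x) y (p y) ≡ true → Independent E (nth d w x) (nth d w y)
    crossing {x} {y} x<L y<L y≢x y≢px hX with x <? p x
    ... | yes x<px = crossing-left-oriented x<L y<L x<px y≢x y≢px hX
    ... | no x≮px  = subst₂ (InE E) (same-generator x<L) refl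
        (crossing-left-oriented (p-< x<L) y<L (below-partner x<L x≮px) y≢px
          (λ e → y≢x (trans e (p-involutive x<L)))
          (trans (trans (cong (λ s → crosses (p x) s y (p y)) (p-involutive x<L))
                        (sym (crosses-flipˡ x (p x) y (p y)))) hX))

  lookup-nth : ∀ d (w : Word k) (i : Fin (length w)) → lookup w i ≡ nth d w (toℕ i)
  lookup-nth d (x ∷ w) zero    = refl
  lookup-nth d (x ∷ w) (suc i) = lookup-nth d w i

  pairing⇒matching : ∀ d w → Pairing d w → Σ (PerfectMatching (length w)) (GoodMatching E w)
  pairing⇒matching d w N = M , inverse , ordered
    where
    P : Fin (length w) → Fin (length w)
    P i = fromℕ< (match-< N (toℕ<n i))
    toℕ-P : ∀ i → toℕ (P i) ≡ match N (toℕ i)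
    toℕ-P i = toℕ-fromℕ< _
    M : PerfectMatching (length w)
    M = record
      { partner    = P
      ; involutive = λ i → toℕ-injective
          (trans (toℕ-P (P i)) (trans (cong (match N) (toℕ-P i)) (match-involutive N (toℕ<n i))))
      ; noFixed    = λ i e → match-≢ N (toℕ<n i) (trans (sym (toℕ-P i)) (cong toℕ e))
      }
    inverse : ∀ i → lookup w (P i) ≡ inv (lookup w i)
    inverse i = begin
      lookup w (P i)               ≡⟨ lookup-nth d w (P i) ⟩
      nth d w (toℕ (P i))          ≡⟨ cong (nth d w) (toℕ-P i) ⟩
      nth d w (match N (toℕ i))    ≡⟨ match-inverse N (toℕ<n i) ⟩
      inv (nth d w (toℕ i))        ≡⟨ cong inv (sym (lookup-nth d w i)) ⟩
      inv (lookup w i) ∎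
    ordered : ∀ i i' → toℕ i < toℕ i' → toℕ i' < toℕ (P i) → toℕ (P i) < toℕ (P i') →
      Independent E (lookup w i) (lookup w i')
    ordered i i' i<i' i'<Pi Pi<Pi' =
      subst₂ (Independent E) (sym (lookup-nth d w i)) (sym (lookup-nth d w i'))
        (crossing-independent N (toℕ<n i) (toℕ<n i') (λ e → <-irrefl (sym e) i<i') (λ e → <-irrefl e i'<pi)
          (interleaved⇒crosses i<i' i'<pi (subst₂ _<_ (toℕ-P i) (toℕ-P i') Pi<Pi')))
      where
      i'<pi : toℕ i' < match N (toℕ i)
      i'<pi = subst (toℕ i' <_) (toℕ-P i) i'<Pi

  -- Conversely a good perfect matching, extended by the identity past the end of w, is a pairing.
  matching⇒pairing : ∀ d w → Σ (PerfectMatching (length w)) (GoodMatching E w) → Pairing d w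
  matching⇒pairing d w (M , inverse , ordered) = record
    { match                = p
    ; match-<              = p-<
    ; match-involutive     = p-involutive
    ; match-≢              = p-≢
    ; match-inverse        = p-inverse
    ; crossing-independent = FromOrdered.crossing d w p p-involutive p-< p-≢ p-inverse ordered-ℕ
    }
    where
    P : Fin (length w) → Fin (length w)
    P = partner M
    p : ℕ → ℕ
    p n with n <? length w
    ... | yes n<L = toℕ (P (fromℕ< n<L))
    ... | no _    = n
    p-toℕ : ∀ i → p (toℕ i) ≡ toℕ (P i)
    p-toℕ i with toℕ i <? length w
    ... | yes i<L = cong (λ j → toℕ (P j)) (fromℕ<-toℕ i i<L)
    ... | no i≮L  = ⊥-elim (i≮L (toℕ<n i))
    at-Fin : {Q : ℕ → Set} → (∀ i → Q (toℕ i)) → ∀ {n} → n < length w → Q n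
    at-Fin {Q} Q-Fin {n} n<L = subst Q (toℕ-fromℕ< n<L) (Q-Fin (fromℕ< n<L))
    p-< : ∀ {n} → n < length w → p n < length w
    p-< = at-Fin (λ i → subst (_< length w) (sym (p-toℕ i)) (toℕ<n (P i)))
    p-involutive : ∀ {n} → n < length w → p (p n) ≡ n
    p-involutive = at-Fin (λ i → trans (cong p (p-toℕ i)) (trans (p-toℕ (P i)) (cong toℕ (involutive M i))))
    p-≢ : ∀ {n} → n < length w → p n ≢ n
    p-≢ = at-Fin (λ i e → noFixed M i (toℕ-injective (trans (sym (p-toℕ i)) e)))
    nth-lookup : ∀ i → nth d w (toℕ i) ≡ lookup w i
    nth-lookup i = sym (lookup-nth d w i)
    p-inverse : ∀ {n} → n < length w → nth d w (p n) ≡ inv (nth d w n)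
    p-inverse = at-Fin (λ i → begin
      nth d w (p (toℕ i))    ≡⟨ cong (nth d w) (p-toℕ i) ⟩
      nth d w (toℕ (P i))    ≡⟨ nth-lookup (P i) ⟩
      lookup w (P i)         ≡⟨ inverse i ⟩
      inv (lookup w i)       ≡⟨ cong inv (sym (nth-lookup i)) ⟩
      inv (nth d w (toℕ i)) ∎)
    Ordered : ℕ → ℕ → Set
    Ordered x y = x < y → y < p x → p x < p y → Independent E (nth d w x) (nth d w y)
    ordered-Fin : ∀ i i' → Ordered (toℕ i) (toℕ i')
    ordered-Fin i i' i<i' i'<pi pi<pi' = subst₂ (Independent E) (sym (nth-lookup i)) (sym (nth-lookup i'))
      (ordered i i' i<i' (subst (toℕ i' <_) (p-toℕ i) i'<pi) (subst₂ _<_ (p-toℕ i) (p-toℕ i') pi<pi'))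
    ordered-ℕ : ∀ {x y} → x < length w → y < length w → Ordered x y
    ordered-ℕ {x} {y} x<L y<L =
      at-Fin {λ x → Ordered x y} (λ i → at-Fin {λ y → Ordered (toℕ i) y} (ordered-Fin i) y<L) x<L

  trivial⇔good-matching : ∀ d w → IsTrivial E w ⇔ Σ (PerfectMatching (length w)) (GoodMatching E w)
  trivial⇔good-matching d w = mk⇔
    (λ w≈[] → pairing⇒matching d w (trivial⇒pairing d w w≈[]))
    (λ good → pairing⇒trivial d (length w) w ≤-refl (matching⇒pairing d w good))

-- The empty word is treated separately since the
-- alphabet may be empty; otherwise its first letter serves as the default letter.
mainTheorem8 : (k : ℕ) (E : Fin k → Fin k → Set) → (∀ i → ¬ E i i) →
    (w : Word k) →
    IsTrivial E w ⇔ Σ (PerfectMatching (length w)) (λ M → GoodMatching E w M)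
mainTheorem8 k E _ []          = mk⇔ (λ _ → no-positions , (λ ()) , (λ ())) (λ _ → ≈-refl)
  where
  no-positions : PerfectMatching 0
  no-positions = record { partner = λ () ; involutive = λ () ; noFixed = λ () }
mainTheorem8 k E _ w@(x ∷ _) = trivial⇔good-matching E x w
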